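{- Let $G$ be a finite simple connected graph, let $E_1,\ldots,E_k$ be its $\Theta^*$-classes, and for each $i$ let $C_i^1,\ldots,C_i^{r_i}$ be the connected components of $G\setminus E_i$. Set $\deg(C_i^j)=\sum_{x\in V(C_i^j)}\deg(x)$ and $\deg^c(C_i^j)=\sum_{x\in V(G)\setminus V(C_i^j)}\deg(x)$ (degrees in $G$). Then $$Gut(G)\geq\frac12\sum_{i=1}^k\sum_{j=1}^{r_i}\deg(C_i^j)\,\deg^c(C_i^j),$$ and equality holds if and only if $G$ is a partial Hamming graph.
   Context: $Gut(G)=\sum_{\{u,v\}\subseteq V(G)}\deg(u)\deg(v)d_G(u,v)$, sum over unordered pairs of distinct vertices. Two edges $u_1v_1$, $u_2v_2$ are in relation $\Theta$ if $d(u_1,u_2)+d(v_1,v_2)\neq d(u_1,v_2)+d(v_1,u_2)$; $\Theta^*$ is its transitive closure, an equivalence relation on $E(G)$. A Hamming graph is a Cartesian product of complete graphs; a partial Hamming graph is a graph isomorphic to an isometric subgraph of a Hamming graph. -}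

module Defs where

open import Data.Nat using (ℕ; zero; suc; _+_; _*_; _<ᵇ_)
open import Data.Fin using (Fin; toℕ; _≟_)
open import Data.Bool using (Bool; true; false; if_then_else_; _∨_; _∧_)
open import Data.Product using (Σ; _×_; _,_; proj₁; proj₂)
open import Relation.Nullary using (¬_; does)
open import Relation.Binary.PropositionalEquality using (_≡_)
open import Relation.Binary.Construct.Closure.ReflexiveTransitive using (Star)
open import Relation.Binary.Construct.Closure.Transitive using (TransClosure)

sumFin : {n : ℕ} → (Fin n → ℕ) → ℕ
sumFin {zero}  f = 0
sumFin {suc n} f = f Fin.zero + sumFin (λ i → f (Fin.suc i))

anyFin : {n : ℕ} → (Fin n → Bool) → Bool
anyFin {zero}  p = false
anyFin {suc n} p = p Fin.zero ∨ anyFin (λ i → p (Fin.suc i))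

countFin : {n : ℕ} → (Fin n → Bool) → ℕ
countFin p = sumFin (λ i → if p i then 1 else 0)

record Graph : Set where
  field
    n       : ℕ
    adj     : Fin n → Fin n → Bool
    adj-sym : ∀ u v → adj u v ≡ adj v u
    irrefl  : ∀ u → adj u u ≡ false
open Graph public

module _ (G : Graph) where

  Adj : Fin (n G) → Fin (n G) → Set
  Adj u v = adj G u v ≡ true

  Connected : Set
  Connected = ∀ u v → Star Adj u v

  deg : Fin (n G) → ℕ
  deg u = countFin (adj G u)

  walkWithin : ℕ → Fin (n G) → Fin (n G) → Bool
  walkWithin zero    u v = does (u ≟ v)
  walkWithin (suc k) u v = walkWithin k u v ∨ anyFin (λ w → adj G u w ∧ walkWithin k w v)

  private
    search : ℕ → ℕ → Fin (n G) → Fin (n G) → ℕ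
    search s zero      u v = s
    search s (suc fuel) u v = if walkWithin s u v then s else search (suc s) fuel u v

  -- graph distance d_G(u,v) = length of a shortest u,v-walk
  -- (in a connected graph on n vertices this is < n; value n if unreachable)
  dist : Fin (n G) → Fin (n G) → ℕ
  dist u v = search 0 (n G) u v

  Gut : ℕ
  Gut = sumFin (λ u → sumFin (λ v →
          if toℕ u <ᵇ toℕ v then deg u * deg v * dist u v else 0))

  -- edges, represented as darts (ordered adjacent pairs)
  Dart : Set
  Dart = Σ (Fin (n G) × Fin (n G)) (λ p → Adj (proj₁ p) (proj₂ p))

  Θ : Dart → Dart → Set
  Θ ((u₁ , v₁) , _) ((u₂ , v₂) , _) =
    ¬ (dist u₁ u₂ + dist v₁ v₂ ≡ dist u₁ v₂ + dist v₁ u₂)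

  Θ* : Dart → Dart → Set
  Θ* = TransClosure Θ

  IsThetaClasses : (k : ℕ) → (Fin k → Fin (n G) → Fin (n G) → Bool) → Set
  IsThetaClasses k E =
      (∀ i u v → E i u v ≡ true → Adj u v)
    × (∀ i → Σ (Fin (n G)) λ u → Σ (Fin (n G)) λ v → E i u v ≡ true)
    × (∀ u v → Adj u v → Σ (Fin k) λ i → E i u v ≡ true)
    × (∀ i j u v → E i u v ≡ true → E j u v ≡ true → i ≡ j)
    × (∀ i (d d' : Dart) → E i (proj₁ (proj₁ d)) (proj₂ (proj₁ d)) ≡ true →
         (E i (proj₁ (proj₁ d')) (proj₂ (proj₁ d')) ≡ true → Θ* d d')
       × (Θ* d d' → E i (proj₁ (proj₁ d')) (proj₂ (proj₁ d')) ≡ true))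

  AdjMinus : (Fin (n G) → Fin (n G) → Bool) → Fin (n G) → Fin (n G) → Set
  AdjMinus F u v = (adj G u v ≡ true) × (F u v ≡ false)

  IsComponents : (F : Fin (n G) → Fin (n G) → Bool) (r : ℕ) → (Fin r → Fin (n G) → Bool) → Set
  IsComponents F r C =
      (∀ j → Σ (Fin (n G)) λ x → C j x ≡ true)
    × (∀ x → Σ (Fin r) λ j → C j x ≡ true)
    × (∀ j j' x → C j x ≡ true → C j' x ≡ true → j ≡ j')
    × (∀ j x y → C j x ≡ true →
         (C j y ≡ true → Star (AdjMinus F) x y) × (Star (AdjMinus F) x y → C j y ≡ true))

  degIn : (Fin (n G) → Bool) → ℕ
  degIn C = sumFin (λ x → if C x then deg x else 0)

  degOut : (Fin (n G) → Bool) → ℕ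
  degOut C = sumFin (λ x → if C x then 0 else deg x)

  -- twice the right-hand side: Σ_i Σ_j deg(C_i^j) deg^c(C_i^j)
  cutSum : (k : ℕ) (r : Fin k → ℕ) (C : (i : Fin k) → Fin (r i) → Fin (n G) → Bool) → ℕ
  cutSum k r C = sumFin (λ i → sumFin (λ j → degIn (C i j) * degOut (C i j)))

-- Hamming distance on the vertex set of K_{q_1} □ ... □ K_{q_m}
-- (= the graph distance of this Hamming graph)
hammingDist : {m : ℕ} {q : Fin m → ℕ} → ((i : Fin m) → Fin (q i)) → ((i : Fin m) → Fin (q i)) → ℕ
hammingDist x y = countFin (λ i → if does (x i ≟ y i) then false else true)

-- G is isomorphic to an isometric subgraph of a Hamming graph,
-- i.e. G admits a distance-preserving map into some Hamming graph
PartialHamming : Graph → Set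
PartialHamming G =
  Σ ℕ λ m → Σ (Fin m → ℕ) λ q → Σ (Fin (n G) → (i : Fin m) → Fin (q i)) λ f →
    ∀ u v → hammingDist {m} {q} (f u) (f v) ≡ dist G u v

{-# OPTIONS --safe #-}

-- Label every vertex x by the component of G ∖ Eᵢ containing it, for each class i, and let
-- s(x, y) be the number of classes whose labels separate x and y: the Hamming distance of
-- the label vectors.  Expanding deg(C) · deg^c(C) shows that the cut sum is
-- Σ_{x,y} deg x · deg y · s(x, y), while 2 · Gut is the same sum with d(x, y) in place of s.
-- Every edge lies in exactly one class and a geodesic from x to y must leave the component
-- of x in each separating class, so s ≤ d; this is the inequality.  Equality forces s = d
-- since all degrees are positive, and then the labelling is an isometric embedding into a
-- Hamming graph.  Conversely, in a partial Hamming graph Θ-related edges change the same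
-- coordinate, so a geodesic crosses each Θ*-class at most once; and it crosses no class
-- leaving x and y in one component, since an edge zw of such a geodesic is Θ-related to
-- some edge of an x–y path avoiding the class (x is nearer to z, y nearer to w).  Hence d ≤ s.
module Submission where

open import Defs
open import Level using (0ℓ)
open import Data.Bool using (Bool; true; false; if_then_else_; _∨_; _∧_; T)
open import Data.Bool.Properties using (∨-zeroʳ; ∨-assoc; ∨-idem)
open import Data.Fin using (Fin; zero; suc; toℕ) renaming (_≟_ to _≟ᶠ_)
open import Data.Fin.Properties using (suc-injective; toℕ-injective)
open import Data.Nat
  using (ℕ; zero; suc; _+_; _*_; _≤_; _<_; _<ᵇ_; _≤′_; ≤′-refl; ≤′-step; z≤n; s≤s; NonZero; >-nonZero)
open import Data.Nat.Properties hiding (suc-injective)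
open import Data.Nat.Tactic.RingSolver using (solve-∀)
open import Algebra.Properties.CommutativeSemigroup +-commutativeSemigroup using (interchange)
open import Data.Product using (Σ; ∃₂; _×_; _,_; proj₁; proj₂)
open import Data.Sum using (_⊎_; inj₁; inj₂)
open import Data.Unit using (tt)
open import Function using (_∘_)
open import Function.Bundles using (_⇔_; mk⇔)
open import Relation.Nullary using (¬_; yes; no; does; contradiction)
open import Relation.Nullary.Decidable using (dec-true; dec-false)
open import Relation.Binary.Core using (Rel)
open import Relation.Binary.Definitions using (Reflexive; Transitive; Decidable)
open import Relation.Binary.PropositionalEquality
open import Relation.Binary.Construct.Closure.ReflexiveTransitive using (Star; ε; _◅_; _◅◅_; revApp; reverse)
open import Relation.Binary.Construct.Closure.Transitive using ([_]; _∷_)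

sumFin-cong : ∀ {m} {f g : Fin m → ℕ} → (∀ i → f i ≡ g i) → sumFin f ≡ sumFin g
sumFin-cong {zero}  f≗g = refl
sumFin-cong {suc m} f≗g = cong₂ _+_ (f≗g zero) (sumFin-cong (f≗g ∘ suc))

sumFin-zero : ∀ m → sumFin {m} (λ _ → 0) ≡ 0
sumFin-zero zero    = refl
sumFin-zero (suc m) = sumFin-zero m

sumFin-+ : ∀ {m} (f g : Fin m → ℕ) → sumFin (λ i → f i + g i) ≡ sumFin f + sumFin g
sumFin-+ {zero}  f g = refl
sumFin-+ {suc m} f g = trans (cong (f zero + g zero +_) (sumFin-+ (f ∘ suc) (g ∘ suc)))
                             (interchange (f zero) (g zero) (sumFin (f ∘ suc)) (sumFin (g ∘ suc)))

sumFin-comm : ∀ {m p} (h : Fin m → Fin p → ℕ) →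
              sumFin (λ i → sumFin (λ j → h i j)) ≡ sumFin (λ j → sumFin (λ i → h i j))
sumFin-comm {zero}  {p} h = sym (sumFin-zero p)
sumFin-comm {suc m} {p} h = trans (cong (sumFin (h zero) +_) (sumFin-comm (h ∘ suc)))
                                  (sym (sumFin-+ (h zero) (λ j → sumFin (λ i → h (suc i) j))))

sumFin-comm₃ : ∀ {k m p} (F : Fin k → Fin m → Fin p → ℕ) →
               sumFin (λ i → sumFin (λ x → sumFin (λ y → F i x y)))
                 ≡ sumFin (λ x → sumFin (λ y → sumFin (λ i → F i x y)))
sumFin-comm₃ F = trans (sumFin-comm (λ i x → sumFin (F i x))) (sumFin-cong (λ x → sumFin-comm (λ i y → F i x y)))

*-distribˡ-sumFin : ∀ {m} a (f : Fin m → ℕ) → a * sumFin f ≡ sumFin (λ i → a * f i)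
*-distribˡ-sumFin {zero}  a f = *-zeroʳ a
*-distribˡ-sumFin {suc m} a f =
  trans (*-distribˡ-+ a (f zero) _) (cong (a * f zero +_) (*-distribˡ-sumFin a (f ∘ suc)))

sumFin-*-sumFin : ∀ {m p} (f : Fin m → ℕ) (g : Fin p → ℕ) →
                  sumFin f * sumFin g ≡ sumFin (λ i → sumFin (λ j → f i * g j))
sumFin-*-sumFin {zero}  f g = refl
sumFin-*-sumFin {suc m} f g = trans (*-distribʳ-+ (sumFin g) (f zero) _)
  (cong₂ _+_ (*-distribˡ-sumFin (f zero) g) (sumFin-*-sumFin (f ∘ suc) g))

sumFin-concentrated : ∀ {m} (f : Fin m → ℕ) i → (∀ j → j ≢ i → f j ≡ 0) → sumFin f ≡ f i
sumFin-concentrated {suc m} f zero    off =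
  trans (cong (f zero +_) (trans (sumFin-cong (λ j → off (suc j) λ ())) (sumFin-zero m))) (+-identityʳ (f zero))
sumFin-concentrated {suc m} f (suc i) off =
  trans (cong (_+ sumFin (f ∘ suc)) (off zero λ ()))
        (sumFin-concentrated (f ∘ suc) i (λ j j≢i → off (suc j) (j≢i ∘ suc-injective)))

sumFin-mono : ∀ {m} {f g : Fin m → ℕ} → (∀ i → f i ≤ g i) → sumFin f ≤ sumFin g
sumFin-mono {zero}  f≤g = z≤n
sumFin-mono {suc m} f≤g = +-mono-≤ (f≤g zero) (sumFin-mono (f≤g ∘ suc))

≤-sumFin : ∀ {m} (f : Fin m → ℕ) i → f i ≤ sumFin f
≤-sumFin f zero    = m≤m+n (f zero) _
≤-sumFin f (suc i) = ≤-trans (≤-sumFin (f ∘ suc) i) (m≤n+m _ (f zero))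

+-tight : ∀ {m n o p} → m ≤ o → n ≤ p → o + p ≤ m + n → m ≡ o × n ≡ p
+-tight {m} {n} {o} {p} m≤o n≤p o+p≤m+n =
  ≤-antisym m≤o (+-cancelʳ-≤ p o m (≤-trans o+p≤m+n (+-monoʳ-≤ m n≤p))) ,
  ≤-antisym n≤p (+-cancelˡ-≤ o p n (≤-trans o+p≤m+n (+-monoˡ-≤ n m≤o)))

sumFin-tight : ∀ {m} {f g : Fin m → ℕ} → (∀ i → f i ≤ g i) → sumFin f ≡ sumFin g → ∀ i → f i ≡ g i
sumFin-tight {suc m} f≤g eq i with +-tight (f≤g zero) (sumFin-mono (f≤g ∘ suc)) (≤-reflexive (sym eq))
sumFin-tight {suc m} f≤g eq zero    | f0≡g0 , _    = f0≡g0
sumFin-tight {suc m} f≤g eq (suc i) | _     , rest = sumFin-tight (f≤g ∘ suc) rest i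

sumFin-≢ : ∀ {m} (f g : Fin m → ℕ) → sumFin f ≢ sumFin g → Σ (Fin m) λ i → f i ≢ g i
sumFin-≢ {zero}  f g ne = contradiction refl ne
sumFin-≢ {suc m} f g ne with f zero ≟ g zero
... | no f0≢g0 = zero , f0≢g0
... | yes f0≡g0 with sumFin-≢ (f ∘ suc) (g ∘ suc) (ne ∘ cong₂ _+_ f0≡g0)
...   | i , fi≢gi = suc i , fi≢gi

sumFin≤1⇒nonzero-unique : ∀ {m} (f : Fin m → ℕ) → sumFin f ≤ 1 → ∀ i j → f i ≢ 0 → f j ≢ 0 → i ≡ j
sumFin≤1⇒nonzero-unique f Σf≤1 zero    zero    _    _    = refl
sumFin≤1⇒nonzero-unique f Σf≤1 zero    (suc j) f0≢0 fj≢0 = contradiction (tail-zero f Σf≤1 f0≢0 j) fj≢0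
  where
  tail-zero : ∀ {m} (f : Fin (suc m) → ℕ) → sumFin f ≤ 1 → f zero ≢ 0 → ∀ j → f (suc j) ≡ 0
  tail-zero f Σf≤1 f0≢0 j = n≤0⇒n≡0 (≤-trans (≤-sumFin (f ∘ suc) j)
                              (+-cancelˡ-≤ 1 _ 0 (≤-trans (+-monoˡ-≤ _ (n≢0⇒n>0 f0≢0)) Σf≤1)))
sumFin≤1⇒nonzero-unique f Σf≤1 (suc i) zero    fi≢0 f0≢0 =
  sym (sumFin≤1⇒nonzero-unique f Σf≤1 zero (suc i) f0≢0 fi≢0)
sumFin≤1⇒nonzero-unique f Σf≤1 (suc i) (suc j) fi≢0 fj≢0 =
  cong suc (sumFin≤1⇒nonzero-unique (f ∘ suc) (m+n≤o⇒n≤o (f zero) Σf≤1) i j fi≢0 fj≢0)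

<ᵇ-true⁻ : ∀ m n → (m <ᵇ n) ≡ true → m < n
<ᵇ-true⁻ m n m<ᵇn = <ᵇ⇒< m n (subst T (sym m<ᵇn) tt)

<ᵇ-false⁻ : ∀ m n → (m <ᵇ n) ≡ false → ¬ m < n
<ᵇ-false⁻ m n m≮ᵇn m<n = subst T m≮ᵇn (<⇒<ᵇ m<n)

2*sumFin-upper≡sumFin : ∀ {m} (h : Fin m → Fin m → ℕ) → (∀ u v → h u v ≡ h v u) → (∀ u → h u u ≡ 0) →
                      2 * sumFin (λ u → sumFin (λ v → if toℕ u <ᵇ toℕ v then h u v else 0))
                        ≡ sumFin (λ u → sumFin (λ v → h u v))
2*sumFin-upper≡sumFin {m} h symmetric diagonal = sym (begin
  sumFin (λ u → sumFin (λ v → h u v))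
    ≡⟨ sumFin-cong (λ u → trans (sumFin-cong (split u)) (sumFin-+ (upper u) (λ v → upper v u))) ⟩
  sumFin (λ u → sumFin (upper u) + sumFin (λ v → upper v u))
    ≡⟨ sumFin-+ (λ u → sumFin (upper u)) (λ u → sumFin (λ v → upper v u)) ⟩
  S + sumFin (λ u → sumFin (λ v → upper v u))
    ≡⟨ cong (S +_) (trans (sumFin-comm (λ u v → upper v u)) (sym (+-identityʳ S))) ⟩
  2 * S ∎)
  where
  open ≡-Reasoning
  upper : Fin m → Fin m → ℕ
  upper u v = if toℕ u <ᵇ toℕ v then h u v else 0
  S : ℕ
  S = sumFin (λ u → sumFin (upper u))
  split : ∀ u v → h u v ≡ upper u v + upper v u
  split u v with toℕ u <ᵇ toℕ v in u<v | toℕ v <ᵇ toℕ u in v<u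
  ... | true  | true  = contradiction (<ᵇ-true⁻ (toℕ v) (toℕ u) v<u) (<⇒≯ (<ᵇ-true⁻ (toℕ u) (toℕ v) u<v))
  ... | true  | false = sym (+-identityʳ (h u v))
  ... | false | true  = symmetric u v
  ... | false | false with toℕ-injective {i = u} {j = v}
                             (≤-antisym (≮⇒≥ (<ᵇ-false⁻ (toℕ v) (toℕ u) v<u)) (≮⇒≥ (<ᵇ-false⁻ (toℕ u) (toℕ v) u<v)))
  ...   | refl = diagonal u

indicator : Bool → ℕ
indicator b = if b then 1 else 0

indicator≤1 : ∀ b → indicator b ≤ 1
indicator≤1 true  = ≤-refl
indicator≤1 false = z≤n

indicator-mono : ∀ {a b} → (a ≡ true → b ≡ true) → indicator a ≤ indicator b
indicator-mono {true}  a⇒b rewrite a⇒b refl = ≤-refl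
indicator-mono {false} a⇒b = z≤n

indicator-injective : ∀ {a b} → indicator a ≡ indicator b → a ≡ b
indicator-injective {true}  {true}  _ = refl
indicator-injective {false} {false} _ = refl

countFin-≤ : ∀ {m} (p : Fin m → Bool) → countFin p ≤ m
countFin-≤ {zero}  p = z≤n
countFin-≤ {suc m} p = +-mono-≤ (indicator≤1 (p zero)) (countFin-≤ (p ∘ suc))

countFin-≥1 : ∀ {m} (p : Fin m → Bool) i → p i ≡ true → 1 ≤ countFin p
countFin-≥1 p i pi = subst (λ b → indicator b ≤ countFin p) pi (≤-sumFin (indicator ∘ p) i)

countFin-≤1 : ∀ {m} (p : Fin m → Bool) → (∀ i j → p i ≡ true → p j ≡ true → i ≡ j) → countFin p ≤ 1
countFin-≤1 {zero}  p unique = z≤n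
countFin-≤1 {suc m} p unique with p zero in p0
... | true  = ≤-reflexive (cong suc (trans (sumFin-cong none-after) (sumFin-zero m)))
  where
  none-after : ∀ i → indicator (p (suc i)) ≡ 0
  none-after i with p (suc i) in pi
  ... | true  = contradiction (unique zero (suc i) p0 pi) λ ()
  ... | false = refl
... | false = countFin-≤1 (p ∘ suc) (λ i j pi pj → suc-injective (unique (suc i) (suc j) pi pj))

∨-true⁻ : ∀ a {b} → a ∨ b ≡ true → a ≡ true ⊎ b ≡ true
∨-true⁻ true  _  = inj₁ refl
∨-true⁻ false ab = inj₂ ab

∧-true⁻ : ∀ a {b} → a ∧ b ≡ true → a ≡ true × b ≡ true
∧-true⁻ true ab = refl , ab

anyFin-intro : ∀ {m} (p : Fin m → Bool) i → p i ≡ true → anyFin p ≡ true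
anyFin-intro p zero    pi = cong (_∨ anyFin (p ∘ suc)) pi
anyFin-intro p (suc i) pi = trans (cong (p zero ∨_) (anyFin-intro (p ∘ suc) i pi)) (∨-zeroʳ (p zero))

anyFin-elim : ∀ {m} (p : Fin m → Bool) → anyFin p ≡ true → Σ (Fin m) λ i → p i ≡ true
anyFin-elim {suc m} p any with ∨-true⁻ (p zero) any
... | inj₁ p0   = zero , p0
... | inj₂ rest with anyFin-elim (p ∘ suc) rest
...   | i , pi = suc i , pi

anyFin-cong : ∀ {m} {p q : Fin m → Bool} → (∀ i → p i ≡ q i) → anyFin p ≡ anyFin q
anyFin-cong {zero}  p≗q = refl
anyFin-cong {suc m} p≗q = cong₂ _∨_ (p≗q zero) (anyFin-cong (p≗q ∘ suc))

-- Written so that hammingDist x y is definitionally sumFin (λ i → mismatch (x i) (y i)).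
mismatch : ∀ {q} → Fin q → Fin q → ℕ
mismatch a b = indicator (if does (a ≟ᶠ b) then false else true)

mismatch-≡ : ∀ {q} {a b : Fin q} → a ≡ b → mismatch a b ≡ 0
mismatch-≡ {a = a} {b} a≡b = cong (λ t → indicator (if t then false else true)) (dec-true (a ≟ᶠ b) a≡b)

mismatch-≢ : ∀ {q} {a b : Fin q} → a ≢ b → mismatch a b ≡ 1
mismatch-≢ {a = a} {b} a≢b = cong (λ t → indicator (if t then false else true)) (dec-false (a ≟ᶠ b) a≢b)

mismatch≢0 : ∀ {q} {a b : Fin q} → a ≢ b → mismatch a b ≢ 0
mismatch≢0 a≢b eq = contradiction (trans (sym (mismatch-≢ a≢b)) eq) λ ()

mismatch≤1 : ∀ {q} (a b : Fin q) → mismatch a b ≤ 1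
mismatch≤1 a b = indicator≤1 _

mismatch-triangle : ∀ {q} (a b c : Fin q) → mismatch a c ≤ mismatch a b + mismatch b c
mismatch-triangle a b c with a ≟ᶠ b
... | yes refl = ≤-refl
... | no  _    = ≤-trans (mismatch≤1 a c) (s≤s z≤n)

mismatch-exchange : ∀ {q} (a b c e : Fin q) → a ≡ b ⊎ c ≡ e →
                    mismatch a c + mismatch b e ≡ mismatch a e + mismatch b c
mismatch-exchange a _ c e (inj₁ refl) = +-comm (mismatch a c) (mismatch a e)
mismatch-exchange _ _ _ _ (inj₂ refl) = refl

+-exchange-trans : ∀ {a a′ a″ b b′ b″} → a + b′ ≡ a′ + b → a′ + b″ ≡ a″ + b′ → a + b″ ≡ a″ + b
+-exchange-trans {a} {a′} {a″} {b} {b′} {b″} e₁ e₂ = +-cancelʳ-≡ (a′ + b′) (a + b″) (a″ + b) (begin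
  (a + b″) + (a′ + b′)  ≡⟨ rearrange a b″ a′ b′ ⟩
  (a + b′) + (a′ + b″)  ≡⟨ cong₂ _+_ e₁ e₂ ⟩
  (a′ + b) + (a″ + b′)  ≡⟨ +-comm (a′ + b) (a″ + b′) ⟩
  (a″ + b′) + (a′ + b)  ≡⟨ rearrange a″ b′ a′ b ⟩
  (a″ + b) + (a′ + b′)  ∎)
  where
  open ≡-Reasoning
  rearrange : ∀ a b c d → (a + b) + (c + d) ≡ (a + d) + (c + b)
  rearrange = solve-∀

Star-breaking-step : ∀ {ℓ ℓʳ ℓᵇ} {A : Set ℓ} {R : Rel A ℓʳ} {B : Rel A ℓᵇ} →
                     Reflexive B → Transitive B → Decidable B →
                     ∀ {x y} → Star R x y → ¬ B x y → ∃₂ λ u v → R u v × ¬ B u v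
Star-breaking-step refl′ trans′ dec ε ¬Bxx = contradiction refl′ ¬Bxx
Star-breaking-step refl′ trans′ dec {x} (_◅_ {j = z} xz zy) ¬Bxy with dec x z
... | no ¬Bxz = x , z , xz , ¬Bxz
... | yes Bxz = Star-breaking-step refl′ trans′ dec zy (¬Bxy ∘ trans′ Bxz)

private
  record HiddenVertex (G : Graph) : Set where
    constructor hide
    field reveal : Fin (n G)
  open HiddenVertex

-- `search` is private to Defs; unification names it: the equation below forces the meta
-- `searchFrom` to be that function.  Hiding the vertices behind a record lets the `with`
-- abstract over the fuel `n G` without making their types ill-formed.
mutual
  searchFrom : (G : Graph) → ℕ → ℕ → Fin (n G) → Fin (n G) → ℕ
  searchFrom = _

  private
    dist≡searchFrom′ : ∀ G (u v : HiddenVertex G) →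
                       dist G (reveal u) (reveal v) ≡ searchFrom G 0 (n G) (reveal u) (reveal v)
    dist≡searchFrom′ G u v with 0 | n G
    ... | start | fuel = refl

dist≡searchFrom : ∀ G (u v : Fin (n G)) → dist G u v ≡ searchFrom G 0 (n G) u v
dist≡searchFrom G u v = dist≡searchFrom′ G (hide u) (hide v)

module Walks (G : Graph) where

  Vertex : Set
  Vertex = Fin (n G)

  Walk : Vertex → Vertex → Set
  Walk = Star (Adj G)

  weight : ∀ {x y} → (Vertex → Vertex → ℕ) → Walk x y → ℕ
  weight w ε                 = 0
  weight w (_◅_ {x} {z} _ P) = w x z + weight w P

  length : ∀ {x y} → Walk x y → ℕ
  length = weight (λ _ _ → 1)

  weight-◅◅ : ∀ {x y z} w (P : Walk x y) (Q : Walk y z) → weight w (P ◅◅ Q) ≡ weight w P + weight w Q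
  weight-◅◅ w ε                 Q = refl
  weight-◅◅ w (_◅_ {x} {z} _ P) Q = trans (cong (w x z +_) (weight-◅◅ w P Q)) (sym (+-assoc (w x z) _ _))

  weight-mono : ∀ {x y} {w w′ : Vertex → Vertex → ℕ} → (∀ a b → w a b ≤ w′ a b) →
                (P : Walk x y) → weight w P ≤ weight w′ P
  weight-mono w≤w′ ε                 = z≤n
  weight-mono w≤w′ (_◅_ {x} {z} _ P) = +-mono-≤ (w≤w′ x z) (weight-mono w≤w′ P)

  weight-cong : ∀ {x y} {w w′ : Vertex → Vertex → ℕ} → (∀ a b → Adj G a b → w a b ≡ w′ a b) →
                (P : Walk x y) → weight w P ≡ weight w′ P
  weight-cong w≗w′ ε                  = refl
  weight-cong w≗w′ (_◅_ {x} {z} xz P) = cong₂ _+_ (w≗w′ x z xz) (weight-cong w≗w′ P)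

  sumFin-weight : ∀ {m x y} (w : Fin m → Vertex → Vertex → ℕ) (P : Walk x y) →
                  sumFin (λ i → weight (w i) P) ≡ weight (λ a b → sumFin (λ i → w i a b)) P
  sumFin-weight {m} w ε                 = sumFin-zero m
  sumFin-weight     w (_◅_ {x} {z} _ P) =
    trans (sumFin-+ (λ i → w i x z) (λ i → weight (w i) P)) (cong (_ +_) (sumFin-weight w P))

  reverseWalk : ∀ {x y} → Walk x y → Walk y x
  reverseWalk = reverse (λ {a} {b} ab → trans (adj-sym G b a) ab)

  length-reverseWalk : ∀ {x y} (P : Walk x y) → length (reverseWalk P) ≡ length P
  length-reverseWalk P = trans (length-revApp P ε) (+-identityʳ (length P))
    where
    length-revApp : ∀ {x y z} (P : Walk y x) (Q : Walk y z) →
                    length (revApp (λ {a} {b} ab → trans (adj-sym G b a) ab) P Q) ≡ length P + length Q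
    length-revApp ε       Q = refl
    length-revApp (_ ◅ P) Q = trans (length-revApp P _) (+-suc (length P) (length Q))

  walkWithin-step : ∀ k {x y} → walkWithin G k x y ≡ true → walkWithin G (suc k) x y ≡ true
  walkWithin-step k {x} {y} r = cong (_∨ anyFin (λ z → adj G x z ∧ walkWithin G k z y)) r

  walkWithin-mono : ∀ {k l x y} → k ≤′ l → walkWithin G k x y ≡ true → walkWithin G l x y ≡ true
  walkWithin-mono ≤′-refl        r = r
  walkWithin-mono {l = suc l} (≤′-step k≤′l) r = walkWithin-step l (walkWithin-mono k≤′l r)

  walk⇒walkWithin : ∀ {x y} (P : Walk x y) → walkWithin G (length P) x y ≡ true
  walk⇒walkWithin {x} ε = dec-true (x ≟ᶠ x) refl
  walk⇒walkWithin {x} {y} (_◅_ {x} {z} xz P) =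
    trans (cong (walkWithin G (length P) x y ∨_)
                (anyFin-intro (λ w → adj G x w ∧ walkWithin G (length P) w y) z
                              (cong₂ _∧_ xz (walk⇒walkWithin P))))
          (∨-zeroʳ _)

  walkWithin⇒walk : ∀ k {x y} → walkWithin G k x y ≡ true → Σ (Walk x y) λ P → length P ≤ k
  walkWithin⇒walk zero {x} {y} r with x ≟ᶠ y
  ... | yes refl = ε , z≤n
  walkWithin⇒walk (suc k) {x} {y} r with ∨-true⁻ (walkWithin G k x y) r
  ... | inj₁ r′ = let P , P≤k = walkWithin⇒walk k r′ in P , m≤n⇒m≤1+n P≤k
  ... | inj₂ some with anyFin-elim (λ z → adj G x z ∧ walkWithin G k z y) some
  ...   | z , xz∧r′ = let xz , r′ = ∧-true⁻ (adj G x z) xz∧r′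
                          P , P≤k = walkWithin⇒walk k r′
                      in xz ◅ P , s≤s P≤k

  Stable : ℕ → Vertex → Set
  Stable k y = ∀ x → walkWithin G (suc k) x y ≡ walkWithin G k x y

  stable-step : ∀ {k y} → Stable k y → Stable (suc k) y
  stable-step {k} {y} st x =
    trans (cong (walkWithin G (suc k) x y ∨_) (anyFin-cong (λ z → cong (adj G x z ∧_) (st z))))
          (trans (∨-assoc (walkWithin G k x y) onward onward) (cong (walkWithin G k x y ∨_) (∨-idem onward)))
    where
    onward : Bool
    onward = anyFin (λ z → adj G x z ∧ walkWithin G k z y)

  stable-mono : ∀ {j l y} → j ≤′ l → Stable j y → Stable l y
  stable-mono ≤′-refl        st = st
  stable-mono {l = suc l} (≤′-step j≤′l) st = stable-step {l} (stable-mono j≤′l st)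

  walkWithin-stable : ∀ {j l y} → j ≤′ l → Stable j y → ∀ x → walkWithin G l x y ≡ walkWithin G j x y
  walkWithin-stable ≤′-refl        st x = refl
  walkWithin-stable (≤′-step j≤′l) st x = trans (stable-mono j≤′l st x) (walkWithin-stable j≤′l st x)

  reachCount : ℕ → Vertex → ℕ
  reachCount k y = countFin (λ x → walkWithin G k x y)

  reachCount-step : ∀ k y x → indicator (walkWithin G k x y) ≤ indicator (walkWithin G (suc k) x y)
  reachCount-step k y x = indicator-mono (walkWithin-step k)

  -- The number of vertices reaching y within k steps grows strictly until reachability
  -- stabilises, so it stabilises by step n.
  stable-or-growing : ∀ y k → (Σ ℕ λ j → j ≤ k × Stable j y) ⊎ k < reachCount k y
  stable-or-growing y zero = inj₂ (countFin-≥1 _ y (walk⇒walkWithin {y} ε))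
  stable-or-growing y (suc k) with stable-or-growing y k
  ... | inj₁ (j , j≤k , st) = inj₁ (j , m≤n⇒m≤1+n j≤k , st)
  ... | inj₂ k<count with reachCount k y ≟ reachCount (suc k) y
  ...   | yes same = inj₁ (k , n≤1+n k ,
                               λ x → sym (indicator-injective (sumFin-tight (reachCount-step k y) same x)))
  ...   | no grew  = inj₂ (≤-<-trans k<count (≤∧≢⇒< (sumFin-mono (reachCount-step k y)) grew))

  stable-within-n : ∀ y → Σ ℕ λ j → j ≤ n G × Stable j y
  stable-within-n y with stable-or-growing y (n G)
  ... | inj₁ found   = found
  ... | inj₂ n<count = contradiction (countFin-≤ _) (<⇒≱ n<count)

  walkWithin⇒walkWithin-n : ∀ l {x y} → walkWithin G l x y ≡ true → walkWithin G (n G) x y ≡ true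
  walkWithin⇒walkWithin-n l {x} {y} r with stable-within-n y
  ... | j , j≤n , st with ≤-total l j
  ...   | inj₁ l≤j = walkWithin-mono (≤⇒≤′ (≤-trans l≤j j≤n)) r
  ...   | inj₂ j≤l = walkWithin-mono (≤⇒≤′ j≤n) (trans (sym (walkWithin-stable (≤⇒≤′ j≤l) st x)) r)

  searchFrom-≤ : ∀ {k x y} → walkWithin G k x y ≡ true → ∀ fuel s → s ≤ k → searchFrom G s fuel x y ≤ k
  searchFrom-≤ r zero s s≤k = s≤k
  searchFrom-≤ {k} {x} {y} r (suc fuel) s s≤k with walkWithin G s x y in found
  ... | true  = s≤k
  ... | false = searchFrom-≤ r fuel (suc s) (≤∧≢⇒< s≤k λ { refl → contradiction (trans (sym r) found) λ () })

  searchFrom-finds : ∀ {x y} fuel s → walkWithin G (s + fuel) x y ≡ true →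
                     walkWithin G (searchFrom G s fuel x y) x y ≡ true
  searchFrom-finds {x} {y} zero s r = subst (λ t → walkWithin G t x y ≡ true) (+-identityʳ s) r
  searchFrom-finds {x} {y} (suc fuel) s r with walkWithin G s x y in found
  ... | true  = found
  ... | false = searchFrom-finds fuel (suc s) (subst (λ t → walkWithin G t x y ≡ true) (+-suc s fuel) r)

  dist-≤-length : ∀ {x y} (P : Walk x y) → dist G x y ≤ length P
  dist-≤-length {x} {y} P = subst (_≤ length P) (sym (dist≡searchFrom G x y))
                                  (searchFrom-≤ (walk⇒walkWithin P) (n G) 0 z≤n)

  dist-refl : ∀ x → dist G x x ≡ 0
  dist-refl x = n≤0⇒n≡0 (dist-≤-length {x} ε)

  shortestWalk : ∀ {x y} → Walk x y → Σ (Walk x y) λ P → length P ≡ dist G x y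
  shortestWalk {x} {y} P = let Q , Q≤d = walkWithin⇒walk (dist G x y) reachable in
    Q , ≤-antisym Q≤d (dist-≤-length Q)
    where
    reachable : walkWithin G (dist G x y) x y ≡ true
    reachable = subst (λ t → walkWithin G t x y ≡ true) (sym (dist≡searchFrom G x y))
                      (searchFrom-finds (n G) 0 (walkWithin⇒walkWithin-n (length P) (walk⇒walkWithin P)))

  crossings : (Vertex → Vertex → Bool) → ∀ {x y} → Walk x y → ℕ
  crossings F = weight (λ a b → indicator (F a b))

  crossing-free-walk : ∀ {F x y} (P : Walk x y) → crossings F P ≡ 0 → Star (AdjMinus G F) x y
  crossing-free-walk ε _ = ε
  crossing-free-walk {F} (_◅_ {x} {z} xz P) none with F x z in xz∈F
  ... | false = (xz , xz∈F) ◅ crossing-free-walk P none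

module Cuts (G : Graph) where
  open Walks G

  degWeighted : (Vertex → Vertex → ℕ) → ℕ
  degWeighted f = sumFin (λ x → sumFin (λ y → deg G x * deg G y * f x y))

  degWeighted-mono : ∀ {f g} → (∀ x y → f x y ≤ g x y) → degWeighted f ≤ degWeighted g
  degWeighted-mono f≤g = sumFin-mono (λ x → sumFin-mono (λ y → *-monoʳ-≤ (deg G x * deg G y) (f≤g x y)))

  partition-cut : ∀ {r} (C : Fin r → Vertex → Bool) (part : Vertex → Fin r) →
                  (∀ x → C (part x) x ≡ true) → (∀ j x → C j x ≡ true → j ≡ part x) →
                  sumFin (λ j → degIn G (C j) * degOut G (C j)) ≡ degWeighted (λ x y → mismatch (part x) (part y))
  partition-cut {r} C part in-part part-unique = begin
    sumFin (λ j → degIn G (C j) * degOut G (C j))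
      ≡⟨ sumFin-cong (λ j → sumFin-*-sumFin (λ x → if C j x then deg G x else 0)
                                            (λ y → if C j y then 0 else deg G y)) ⟩
    sumFin (λ j → sumFin (λ x → sumFin (λ y → term j x y)))
      ≡⟨ sumFin-comm₃ term ⟩
    sumFin (λ x → sumFin (λ y → sumFin (λ j → term j x y)))
      ≡⟨ sumFin-cong (λ x → sumFin-cong (λ y →
           trans (sumFin-concentrated (λ j → term j x y) (part x) (term-off x y)) (term-on x y))) ⟩
    degWeighted (λ x y → mismatch (part x) (part y)) ∎
    where
    open ≡-Reasoning
    term : Fin r → Vertex → Vertex → ℕ
    term j x y = (if C j x then deg G x else 0) * (if C j y then 0 else deg G y)
    term-off : ∀ x y j → j ≢ part x → term j x y ≡ 0
    term-off x y j j≢part with C j x in x∈j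
    ... | true  = contradiction (part-unique j x x∈j) j≢part
    ... | false = refl
    term-on : ∀ x y → term (part x) x y ≡ deg G x * deg G y * mismatch (part x) (part y)
    term-on x y rewrite in-part x with C (part x) y in y∈part
    ... | true  = trans (*-zeroʳ (deg G x))
                        (sym (trans (cong (deg G x * deg G y *_) (mismatch-≡ (part-unique (part x) y y∈part)))
                                    (*-zeroʳ (deg G x * deg G y))))
    ... | false = sym (trans (cong (deg G x * deg G y *_) (mismatch-≢ separated)) (*-identityʳ _))
      where
      separated : part x ≢ part y
      separated same =
        contradiction (trans (sym y∈part) (subst (λ j → C j y ≡ true) (sym same) (in-part y))) λ ()

  cutSum-hamming : ∀ k (r : Fin k → ℕ) (C : (i : Fin k) → Fin (r i) → Vertex → Bool)
                   (part : Vertex → (i : Fin k) → Fin (r i)) →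
                   (∀ x i → C i (part x i) x ≡ true) → (∀ i j x → C i j x ≡ true → j ≡ part x i) →
                   cutSum G k r C ≡ degWeighted (λ x y → hammingDist (part x) (part y))
  cutSum-hamming k r C part in-part part-unique = begin
    cutSum G k r C
      ≡⟨ sumFin-cong (λ i → partition-cut (C i) (λ x → part x i) (λ x → in-part x i) (part-unique i)) ⟩
    sumFin (λ i → degWeighted (λ x y → mismatch (part x i) (part y i)))
      ≡⟨ sumFin-comm₃ (λ i x y → deg G x * deg G y * mismatch (part x i) (part y i)) ⟩
    sumFin (λ x → sumFin (λ y → sumFin (λ i → deg G x * deg G y * mismatch (part x i) (part y i))))
      ≡⟨ sumFin-cong (λ x → sumFin-cong (λ y →
           sym (*-distribˡ-sumFin (deg G x * deg G y) (λ i → mismatch (part x i) (part y i))))) ⟩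
    degWeighted (λ x y → hammingDist (part x) (part y)) ∎
    where open ≡-Reasoning

  2*Gut≡degWeighted : (∀ x y → dist G x y ≡ dist G y x) → 2 * Gut G ≡ degWeighted (dist G)
  2*Gut≡degWeighted dist-sym = 2*sumFin-upper≡sumFin (λ x y → deg G x * deg G y * dist G x y)
    (λ x y → cong₂ _*_ (*-comm (deg G x) (deg G y)) (dist-sym x y))
    (λ x → trans (cong (deg G x * deg G x *_) (dist-refl x)) (*-zeroʳ (deg G x * deg G x)))

module Metric (G : Graph) (connected : Connected G) where
  open Walks G
  open Cuts G

  geodesic : ∀ x y → Σ (Walk x y) λ P → length P ≡ dist G x y
  geodesic x y = shortestWalk (connected x y)

  dist-sym : ∀ x y → dist G x y ≡ dist G y x
  dist-sym x y = ≤-antisym (dist-≤-reverse x y) (dist-≤-reverse y x)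
    where
    dist-≤-reverse : ∀ x y → dist G x y ≤ dist G y x
    dist-≤-reverse x y = let P , P≡d = geodesic y x in
      ≤-trans (dist-≤-length (reverseWalk P)) (≤-reflexive (trans (length-reverseWalk P) P≡d))

  dist-triangle : ∀ x y z → dist G x z ≤ dist G x y + dist G y z
  dist-triangle x y z = let P , P≡d = geodesic x y; Q , Q≡d = geodesic y z in
    ≤-trans (dist-≤-length (P ◅◅ Q)) (≤-reflexive (trans (weight-◅◅ _ P Q) (cong₂ _+_ P≡d Q≡d)))

  dist-adjacent : ∀ {x y} → Adj G x y → dist G x y ≡ 1
  dist-adjacent {x} {y} xy = ≤-antisym (dist-≤-length (xy ◅ ε)) (n≢0⇒n>0 d≢0)
    where
    d≢0 : dist G x y ≢ 0
    d≢0 d≡0 with geodesic x y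
    ... | ε     , _    = contradiction (trans (sym xy) (irrefl G x)) λ ()
    ... | _ ◅ _ , P≡d = contradiction (trans P≡d d≡0) λ ()

  deg-pos : ∀ {x y} → x ≢ y → 0 < deg G x
  deg-pos {x} {y} x≢y with connected x y
  ... | ε      = contradiction refl x≢y
  ... | xz ◅ _ = countFin-≥1 (adj G x) _ xz

  degWeighted-tight : ∀ {f g} → (∀ x y → f x y ≤ g x y) → degWeighted f ≡ degWeighted g →
                      ∀ {x y} → x ≢ y → f x y ≡ g x y
  degWeighted-tight {f} {g} f≤g same {x} {y} x≢y =
    *-cancelˡ-≡ (f x y) (g x y) (deg G x * deg G y) {{degs≢0}} entry
    where
    weighted≤ : ∀ x y → deg G x * deg G y * f x y ≤ deg G x * deg G y * g x y
    weighted≤ x y = *-monoʳ-≤ (deg G x * deg G y) (f≤g x y)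
    row : sumFin (λ y → deg G x * deg G y * f x y) ≡ sumFin (λ y → deg G x * deg G y * g x y)
    row = sumFin-tight (λ x → sumFin-mono (weighted≤ x)) same x
    entry : deg G x * deg G y * f x y ≡ deg G x * deg G y * g x y
    entry = sumFin-tight (weighted≤ x) row y
    degs≢0 : NonZero (deg G x * deg G y)
    degs≢0 = m*n≢0 (deg G x) (deg G y) {{>-nonZero (deg-pos x≢y)}} {{>-nonZero (deg-pos (x≢y ∘ sym))}}

  geodesic-split : ∀ {x y z} (P : Walk x y) (Q : Walk y z) → length P + length Q ≡ dist G x z →
                   dist G x y ≡ length P × dist G y z ≡ length Q
  geodesic-split P Q P+Q≡d =
    +-tight (dist-≤-length P) (dist-≤-length Q) (≤-trans (≤-reflexive P+Q≡d) (dist-triangle _ _ _))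

  -- ¬ Balanced z w p p′ is, by definition, Θ between the edges zw and pp′.
  Balanced : Vertex → Vertex → Rel Vertex 0ℓ
  Balanced z w p p′ = dist G z p + dist G w p′ ≡ dist G z p′ + dist G w p

  balanced-trans : ∀ z w → Transitive (Balanced z w)
  balanced-trans z w {p} {p′} {p″} = +-exchange-trans {dist G z p} {dist G z p′} {dist G z p″}
                                                      {dist G w p} {dist G w p′} {dist G w p″}

  geodesic-edge-unbalanced : ∀ {x z w y} (Q : Walk x z) (zw : Adj G z w) (R : Walk w y) →
                             length Q + suc (length R) ≡ dist G x y → ¬ Balanced z w x y
  geodesic-edge-unbalanced {x} {z} {w} {y} Q zw R Q+R≡d balanced = m≢1+m+n (a + b) (begin
    a + b                    ≡⟨ sym (cong₂ _+_ (trans (dist-sym z x) (proj₁ at-z)) (proj₂ at-w)) ⟩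
    dist G z x + dist G w y  ≡⟨ balanced ⟩
    dist G z y + dist G w x  ≡⟨ cong₂ _+_ (proj₂ at-z) (trans (dist-sym w x) x→w) ⟩
    suc b + (a + 1)          ≡⟨ shift a b ⟩
    suc (a + b + 1)          ∎)
    where
    open ≡-Reasoning
    a b : ℕ
    a = length Q
    b = length R
    shift : ∀ a b → suc b + (a + 1) ≡ suc (a + b + 1)
    shift = solve-∀
    Q+zw≡a+1 : length (Q ◅◅ zw ◅ ε) ≡ a + 1
    Q+zw≡a+1 = weight-◅◅ _ Q (zw ◅ ε)
    at-z : dist G x z ≡ a × dist G z y ≡ suc b
    at-z = geodesic-split Q (zw ◅ R) Q+R≡d
    at-w : dist G x w ≡ length (Q ◅◅ zw ◅ ε) × dist G w y ≡ b
    at-w = geodesic-split (Q ◅◅ zw ◅ ε) R (trans (cong (_+ b) Q+zw≡a+1) (trans (+-assoc a 1 b) Q+R≡d))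
    x→w : dist G x w ≡ a + 1
    x→w = trans (proj₁ at-w) Q+zw≡a+1

  ΘClosed : (Vertex → Vertex → Bool) → Set
  ΘClosed F = ∀ {z w p p′} (zw : Adj G z w) (pp′ : Adj G p p′) →
              F z w ≡ true → Θ G ((z , w) , zw) ((p , p′) , pp′) → F p p′ ≡ true

  ΘClosed-off-geodesic : ∀ {F} → ΘClosed F → ∀ {x z w y} → Star (AdjMinus G F) x y →
                         (Q : Walk x z) (zw : Adj G z w) (R : Walk w y) →
                         length Q + suc (length R) ≡ dist G x y → F z w ≢ true
  ΘClosed-off-geodesic {F} closed {z = z} {w} avoiding Q zw R Q+R≡d zw∈F
    with Star-breaking-step refl (balanced-trans z w) (λ p p′ → _ ≟ _) avoiding
                            (geodesic-edge-unbalanced Q zw R Q+R≡d)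
  ... | p , p′ , (pp′ , pp′∉F) , unbalanced =
    contradiction (trans (sym pp′∉F) (closed zw pp′ zw∈F unbalanced)) λ ()

  geodesic-avoids-ΘClosed : ∀ {F} → ΘClosed F → ∀ {x y} → Star (AdjMinus G F) x y →
                            (P : Walk x y) → length P ≡ dist G x y → crossings F P ≡ 0
  geodesic-avoids-ΘClosed {F} closed {x} {y} avoiding = avoids-after ε
    where
    avoids-after : ∀ {z} (Q : Walk x z) (R : Walk z y) → length Q + length R ≡ dist G x y → crossings F R ≡ 0
    avoids-after Q ε _ = refl
    avoids-after Q (_◅_ {z} {w} zw R) Q+R≡d with F z w in zw∈F
    ... | true  = contradiction zw∈F (ΘClosed-off-geodesic closed avoiding Q zw R Q+R≡d)
    ... | false = avoids-after (Q ◅◅ zw ◅ ε) R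
      (trans (cong (_+ length R) (weight-◅◅ _ Q (zw ◅ ε))) (trans (+-assoc (length Q) 1 (length R)) Q+R≡d))

module HammingEmbedding (G : Graph) (connected : Connected G) {m} {q : Fin m → ℕ}
                        (h : Fin (n G) → (c : Fin m) → Fin (q c))
                        (isometric : ∀ u v → hammingDist (h u) (h v) ≡ dist G u v) where
  open Walks G
  open Metric G connected

  change : Fin m → Vertex → Vertex → ℕ
  change c a b = mismatch (h a c) (h b c)

  Changes : Fin m → Dart G → Set
  Changes c ((a , b) , _) = h a c ≢ h b c

  change-≤-weight : ∀ c {x y} (P : Walk x y) → change c x y ≤ weight (change c) P
  change-≤-weight c {x} ε                 = ≤-reflexive (mismatch-≡ {a = h x c} refl)
  change-≤-weight c {x} {y} (_◅_ {x} {z} _ P) =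
    ≤-trans (mismatch-triangle (h x c) (h z c) (h y c)) (+-monoʳ-≤ (change c x z) (change-≤-weight c P))

  edge-changes-once : ∀ {a b} → Adj G a b → sumFin (λ c → change c a b) ≡ 1
  edge-changes-once ab = trans (isometric _ _) (dist-adjacent ab)

  edge-coordinate : ∀ (d : Dart G) → Σ (Fin m) λ c → Changes c d
  edge-coordinate ((a , b) , ab) =
    let c , change≢0 = sumFin-≢ (λ c → change c a b) (λ _ → 0) changes in c , change≢0 ∘ mismatch-≡
    where
    changes : sumFin (λ c → change c a b) ≢ sumFin {m} (λ _ → 0)
    changes eq = contradiction (trans (sym (edge-changes-once ab)) (trans eq (sumFin-zero m))) λ ()

  edge-coordinate-unique : ∀ (d : Dart G) {c c′} → Changes c d → Changes c′ d → c ≡ c′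
  edge-coordinate-unique ((a , b) , ab) ch ch′ =
    sumFin≤1⇒nonzero-unique (λ c → change c a b) (≤-reflexive (edge-changes-once ab)) _ _
                            (mismatch≢0 ch) (mismatch≢0 ch′)

  geodesic-changes-once : ∀ {x y} (P : Walk x y) → length P ≡ dist G x y →
                          ∀ c → weight (change c) P ≤ 1
  geodesic-changes-once {x} {y} P P≡d c =
    subst (_≤ 1) (sumFin-tight (λ c → change-≤-weight c P) total c) (mismatch≤1 (h x c) (h y c))
    where
    open ≡-Reasoning
    total : sumFin (λ c → change c x y) ≡ sumFin (λ c → weight (change c) P)
    total = begin
      sumFin (λ c → change c x y)                     ≡⟨ isometric x y ⟩
      dist G x y                                      ≡⟨ sym P≡d ⟩
      length P                                        ≡⟨ weight-cong (λ a b ab → sym (edge-changes-once ab)) P ⟩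
      weight (λ a b → sumFin (λ c → change c a b)) P  ≡⟨ sym (sumFin-weight change P) ⟩
      sumFin (λ c → weight (change c) P)              ∎

  -- Distances are sums over coordinates, so Θ fails already in one coordinate c₀, and a
  -- coordinate left unchanged by either edge contributes equally to both sides of Θ.
  Θ-coordinate : ∀ (d d′ : Dart G) → Θ G d d′ → ∀ {c} → Changes c d → Changes c d′
  Θ-coordinate d@((u , v) , _) d′@((u′ , v′) , _) θ ch =
    subst (λ c → Changes c d′) (edge-coordinate-unique d ch₀ ch) ch₀′
    where
    open ≡-Reasoning
    unbalanced : sumFin (λ c → change c u u′ + change c v v′)
               ≢ sumFin (λ c → change c u v′ + change c v u′)
    unbalanced eq = θ (begin
      dist G u u′ + dist G v v′
        ≡⟨ sym (cong₂ _+_ (isometric u u′) (isometric v v′)) ⟩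
      sumFin (λ c → change c u u′) + sumFin (λ c → change c v v′)
        ≡⟨ sym (sumFin-+ (λ c → change c u u′) (λ c → change c v v′)) ⟩
      sumFin (λ c → change c u u′ + change c v v′)
        ≡⟨ eq ⟩
      sumFin (λ c → change c u v′ + change c v u′)
        ≡⟨ sumFin-+ (λ c → change c u v′) (λ c → change c v u′) ⟩
      sumFin (λ c → change c u v′) + sumFin (λ c → change c v u′)
        ≡⟨ cong₂ _+_ (isometric u v′) (isometric v u′) ⟩
      dist G u v′ + dist G v u′ ∎)
    witness : Σ (Fin m) λ c → change c u u′ + change c v v′ ≢ change c u v′ + change c v u′
    witness = sumFin-≢ (λ c → change c u u′ + change c v v′) (λ c → change c u v′ + change c v u′) unbalanced
    c₀ : Fin m
    c₀ = proj₁ witness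
    ch₀ : h u c₀ ≢ h v c₀
    ch₀ same = proj₂ witness (mismatch-exchange (h u c₀) (h v c₀) (h u′ c₀) (h v′ c₀) (inj₁ same))
    ch₀′ : h u′ c₀ ≢ h v′ c₀
    ch₀′ same = proj₂ witness (mismatch-exchange (h u c₀) (h v c₀) (h u′ c₀) (h v′ c₀) (inj₂ same))

  Θ*-coordinate : ∀ {d d′ : Dart G} → Θ* G d d′ → ∀ {c} → Changes c d → Changes c d′
  Θ*-coordinate {d} {d′} [ θ ]               ch = Θ-coordinate d d′ θ ch
  Θ*-coordinate {d}      (_∷_ {y = d″} θ θ*) ch = Θ*-coordinate θ* (Θ-coordinate d d″ θ ch)

module ThetaCuts (G : Graph) (connected : Connected G)
                 (k : ℕ) (E : Fin k → Fin (n G) → Fin (n G) → Bool) (classes : IsThetaClasses G k E)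
                 (r : Fin k → ℕ) (C : (i : Fin k) → Fin (r i) → Fin (n G) → Bool)
                 (components : ∀ i → IsComponents G (E i) (r i) (C i)) where
  open Walks G
  open Metric G connected
  open Cuts G

  private
    E⇒adj : ∀ i a b → E i a b ≡ true → Adj G a b
    E⇒adj = proj₁ classes

    E-nonempty : ∀ i → Σ Vertex λ a → Σ Vertex λ b → E i a b ≡ true
    E-nonempty = proj₁ (proj₂ classes)

    E-cover : ∀ a b → Adj G a b → Σ (Fin k) λ i → E i a b ≡ true
    E-cover = proj₁ (proj₂ (proj₂ classes))

    E-disjoint : ∀ i j a b → E i a b ≡ true → E j a b ≡ true → i ≡ j
    E-disjoint = proj₁ (proj₂ (proj₂ (proj₂ classes)))

    E-Θ*-class : ∀ i {a b a′ b′} (ab : Adj G a b) (a′b′ : Adj G a′ b′) → E i a b ≡ true →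
                 (E i a′ b′ ≡ true → Θ* G ((a , b) , ab) ((a′ , b′) , a′b′))
               × (Θ* G ((a , b) , ab) ((a′ , b′) , a′b′) → E i a′ b′ ≡ true)
    E-Θ*-class i ab a′b′ = proj₂ (proj₂ (proj₂ (proj₂ classes))) i (_ , ab) (_ , a′b′)

  component : Vertex → (i : Fin k) → Fin (r i)
  component x i = proj₁ (proj₁ (proj₂ (components i)) x)

  in-component : ∀ x i → C i (component x i) x ≡ true
  in-component x i = proj₂ (proj₁ (proj₂ (components i)) x)

  component-unique : ∀ i j x → C i j x ≡ true → j ≡ component x i
  component-unique i j x x∈j =
    proj₁ (proj₂ (proj₂ (components i))) j (component x i) x x∈j (in-component x i)

  component-connected : ∀ i {x y} → component x i ≡ component y i → Star (AdjMinus G (E i)) x y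
  component-connected i {x} {y} same =
    proj₁ (proj₂ (proj₂ (proj₂ (components i))) (component x i) x y (in-component x i))
          (subst (λ j → C i j y ≡ true) (sym same) (in-component y i))

  component-closed : ∀ i {x y} → Star (AdjMinus G (E i)) x y → component x i ≡ component y i
  component-closed i {x} {y} W = component-unique i (component x i) y
    (proj₂ (proj₂ (proj₂ (proj₂ (components i))) (component x i) x y (in-component x i)) W)

  separation : Vertex → Vertex → ℕ
  separation x y = hammingDist (component x) (component y)

  separation-refl : ∀ x → separation x x ≡ 0
  separation-refl x = trans (sumFin-cong (λ i → mismatch-≡ {a = component x i} refl)) (sumFin-zero k)

  cutSum≡degWeighted-separation : cutSum G k r C ≡ degWeighted separation
  cutSum≡degWeighted-separation = cutSum-hamming k r C component in-component component-unique

  classCount : Vertex → Vertex → ℕ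
  classCount a b = countFin (λ i → E i a b)

  classCount≤1 : ∀ a b → classCount a b ≤ 1
  classCount≤1 a b = countFin-≤1 (λ i → E i a b) (λ i j → E-disjoint i j a b)

  classCount-edge : ∀ {a b} → Adj G a b → classCount a b ≡ 1
  classCount-edge {a} {b} ab = let i , ab∈Eᵢ = E-cover a b ab in
    ≤-antisym (classCount≤1 a b) (countFin-≥1 (λ i → E i a b) i ab∈Eᵢ)

  E-ΘClosed : ∀ i → ΘClosed (E i)
  E-ΘClosed i zw pp′ zw∈E θ = proj₂ (E-Θ*-class i zw pp′ zw∈E) [ θ ]

  mismatch-≤-crossings : ∀ i {x y} (P : Walk x y) →
                         mismatch (component x i) (component y i) ≤ crossings (E i) P
  mismatch-≤-crossings i {x} {y} P with crossings (E i) P ≟ 0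
  ... | yes none =
    ≤-reflexive (trans (mismatch-≡ (component-closed i (crossing-free-walk P none))) (sym none))
  ... | no  some = ≤-trans (mismatch≤1 (component x i) (component y i)) (n≢0⇒n>0 some)

  separation≤dist : ∀ x y → separation x y ≤ dist G x y
  separation≤dist x y = let P , P≡d = geodesic x y in begin
    separation x y                      ≤⟨ sumFin-mono (λ i → mismatch-≤-crossings i P) ⟩
    sumFin (λ i → crossings (E i) P)   ≡⟨ sumFin-weight (λ i a b → indicator (E i a b)) P ⟩
    weight classCount P                 ≤⟨ weight-mono classCount≤1 P ⟩
    length P                            ≡⟨ P≡d ⟩
    dist G x y                          ∎
    where open ≤-Reasoning

  module _ {m} {q : Fin m → ℕ} (h : Vertex → (c : Fin m) → Fin (q c))
           (isometric : ∀ u v → hammingDist (h u) (h v) ≡ dist G u v) where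
    open HammingEmbedding G connected h isometric

    class-coordinate : ∀ i → Σ (Fin m) λ c →
                       ∀ {a b} (ab∈Eᵢ : E i a b ≡ true) → Changes c ((a , b) , E⇒adj i a b ab∈Eᵢ)
    class-coordinate i with E-nonempty i
    ... | u , v , uv∈Eᵢ with edge-coordinate ((u , v) , E⇒adj i u v uv∈Eᵢ)
    ...   | c , uv-changes = c , λ {a} {b} ab∈Eᵢ →
      Θ*-coordinate (proj₁ (E-Θ*-class i (E⇒adj i u v uv∈Eᵢ) (E⇒adj i a b ab∈Eᵢ) uv∈Eᵢ) ab∈Eᵢ) uv-changes

    crossings-≤-mismatch : ∀ i {x y} (P : Walk x y) → length P ≡ dist G x y →
                           crossings (E i) P ≤ mismatch (component x i) (component y i)
    crossings-≤-mismatch i {x} {y} P P≡d with component x i ≟ᶠ component y i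
    ... | yes same = ≤-reflexive (geodesic-avoids-ΘClosed (E-ΘClosed i) (component-connected i same) P P≡d)
    ... | no  _    = ≤-trans (weight-mono in-coordinate P) (geodesic-changes-once P P≡d c)
      where
      c = proj₁ (class-coordinate i)
      in-coordinate : ∀ a b → indicator (E i a b) ≤ change c a b
      in-coordinate a b with E i a b in ab∈Eᵢ
      ... | true  = ≤-reflexive (sym (mismatch-≢ (proj₂ (class-coordinate i) ab∈Eᵢ)))
      ... | false = z≤n

    dist≤separation : ∀ x y → dist G x y ≤ separation x y
    dist≤separation x y = let P , P≡d = geodesic x y in begin
      dist G x y                          ≡⟨ sym P≡d ⟩
      length P                            ≡⟨ weight-cong (λ a b ab → sym (classCount-edge ab)) P ⟩
      weight classCount P                 ≡⟨ sym (sumFin-weight (λ i a b → indicator (E i a b)) P) ⟩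
      sumFin (λ i → crossings (E i) P)   ≤⟨ sumFin-mono (λ i → crossings-≤-mismatch i P P≡d) ⟩
      separation x y                      ∎
      where open ≤-Reasoning

mainTheorem12 : (G : Graph) → Connected G →
    (k : ℕ) (E : Fin k → Fin (n G) → Fin (n G) → Bool) → IsThetaClasses G k E →
    (r : Fin k → ℕ) (C : (i : Fin k) → Fin (r i) → Fin (n G) → Bool) →
    (∀ i → IsComponents G (E i) (r i) (C i)) →
    (cutSum G k r C ≤ 2 * Gut G) × ((2 * Gut G ≡ cutSum G k r C) ⇔ PartialHamming G)
mainTheorem12 G connected k E classes r C components =
  cutSum≤2*Gut , mk⇔ equality⇒partialHamming partialHamming⇒equality
  where
  open Walks G
  open Cuts G
  open Metric G connected
  open ThetaCuts G connected k E classes r C components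

  cut≡ : cutSum G k r C ≡ degWeighted separation
  cut≡ = cutSum≡degWeighted-separation

  gut≡ : 2 * Gut G ≡ degWeighted (dist G)
  gut≡ = 2*Gut≡degWeighted dist-sym

  cutSum≤2*Gut : cutSum G k r C ≤ 2 * Gut G
  cutSum≤2*Gut = subst₂ _≤_ (sym cut≡) (sym gut≡) (degWeighted-mono separation≤dist)

  equality⇒partialHamming : 2 * Gut G ≡ cutSum G k r C → PartialHamming G
  equality⇒partialHamming equal = k , r , component , separation≡dist
    where
    separation≡dist : ∀ u v → separation u v ≡ dist G u v
    separation≡dist u v with u ≟ᶠ v
    ... | yes refl = trans (separation-refl u) (sym (dist-refl u))
    ... | no  u≢v  = degWeighted-tight separation≤dist (trans (sym cut≡) (trans (sym equal) gut≡)) u≢v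

  partialHamming⇒equality : PartialHamming G → 2 * Gut G ≡ cutSum G k r C
  partialHamming⇒equality (_ , _ , h , isometric) = subst₂ _≡_ (sym gut≡) (sym cut≡)
    (≤-antisym (degWeighted-mono (dist≤separation h isometric)) (degWeighted-mono separation≤dist))
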